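{- Let $\mathbf{M}\colon\mathcal{I}\times\mathcal{J}\to\mathbb{Z}$ be a tame $0$-tiling. Then there are sequences of rationals $(r_i)_{i\in\mathcal{I}^*}$ and $(s_j)_{j\in\mathcal{J}^*}$ such that \[ m_{i-1,j}+m_{i+1,j}=r_im_{i,j}\quad\text{and}\quad m_{i,j-1}+m_{i,j+1}=s_jm_{i,j} \] for $i\in\mathcal{I}^*$, $j\in\mathcal{J}^*$.
   Context: Index sets $\mathcal{I},\mathcal{J}$ are sets of consecutive integers of length at least 3 (possibly infinite) containing $0,1$; $\mathcal{I}^*$ is $\mathcal{I}$ with its least element (if any) and greatest element (if any) removed. For a positive integer $R$, $\mathscr{F}_R$ is the directed graph with vertices $(a,b)\in\mathbb{Z}^2\setminus\{(0,0)\}$ with $\gcd(a,b)\mid R$, written $a/b$, and edges $a/b\to c/d$ iff $ad-bc=R$; a path is $(a_i/b_i)_i$ with an edge from each vertex to the next; minimal if the gcd of all $a_jb_i-b_ja_i$ is $1$. A $0$-tiling is an integer array all of whose contiguous $2\times2$ subblocks have determinant $0$; it is tame if there are positive integers $K,R,S$ and minimal paths $(a_i/b_i)_{i\in\mathcal{I}}$ in $\mathscr{F}_R$ and $(c_j/d_j)_{j\in\mathcal{J}}$ in $\mathscr{F}_S$ with $m_{ij}=Ka_id_j$ for all $i,j$. -}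

module Defs where

open import Data.Nat as ℕ using (ℕ; NonZero)
open import Data.Nat.GCD using (gcd)
open import Data.Nat.Divisibility using (_∣_)
open import Data.Integer as ℤ using (ℤ; +_; _+_; _-_; _*_; ∣_∣; _≤_; _<_; 0ℤ; 1ℤ)
open import Data.Rational as ℚ using (ℚ; _/_)
open import Data.Maybe using (Maybe; just; nothing)
open import Data.Product using (Σ; ∃; ∃-syntax; _×_; _,_)
open import Data.Unit using (⊤)
open import Relation.Binary.PropositionalEquality using (_≡_)
open import Relation.Nullary using (¬_)

-- Bounds of an interval of integers; `nothing` = unbounded on that side.
LowerOK : Maybe ℤ → ℤ → Set
LowerOK nothing  i = ⊤
LowerOK (just l) i = l ≤ i

UpperOK : Maybe ℤ → ℤ → Set
UpperOK nothing  i = ⊤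
UpperOK (just u) i = i ≤ u

StrictLower : Maybe ℤ → ℤ → Set
StrictLower nothing  i = ⊤
StrictLower (just l) i = l < i

StrictUpper : Maybe ℤ → ℤ → Set
StrictUpper nothing  i = ⊤
StrictUpper (just u) i = i < u

InInterval : Maybe ℤ → Maybe ℤ → ℤ → Set
InInterval l u i = LowerOK l i × UpperOK u i

-- An index set: the set of consecutive integers {i | lo ≤ i ≤ hi}
-- (each bound possibly absent), containing 0 and 1, of length ≥ 3.
record IndexSet : Set where
  field
    lo : Maybe ℤ
    hi : Maybe ℤ
    has0 : InInterval lo hi 0ℤ
    has1 : InInterval lo hi 1ℤ
    long : ∃[ k ] (InInterval lo hi k × InInterval lo hi (k + 1ℤ) × InInterval lo hi (k + + 2))

open IndexSet public

_∈_ : ℤ → IndexSet → Set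
i ∈ I = InInterval (lo I) (hi I) i

_∈*_ : ℤ → IndexSet → Set
i ∈* I = StrictLower (lo I) i × StrictUpper (hi I) i

IsVertex : ℕ → ℤ → ℤ → Set
IsVertex R a b = ¬ (a ≡ 0ℤ × b ≡ 0ℤ) × (gcd (∣ a ∣) (∣ b ∣) ∣ R)

IsPath : ℕ → IndexSet → (ℤ → ℤ) → (ℤ → ℤ) → Set
IsPath R I a b =
  (∀ i → i ∈ I → IsVertex R (a i) (b i)) ×
  (∀ i → i ∈ I → (i + 1ℤ) ∈ I → a i * b (i + 1ℤ) - b i * a (i + 1ℤ) ≡ + R)

-- Minimal: the gcd of all a_j b_i - b_j a_i (i,j ∈ I) is 1, i.e. the only
-- natural number dividing all of them is 1.
IsMinimal : IndexSet → (ℤ → ℤ) → (ℤ → ℤ) → Set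
IsMinimal I a b =
  ∀ (d : ℕ) → (∀ i j → i ∈ I → j ∈ I → d ∣ (∣ a j * b i - b j * a i ∣)) → d ≡ 1

IsMinimalPath : ℕ → IndexSet → (ℤ → ℤ) → (ℤ → ℤ) → Set
IsMinimalPath R I a b = IsPath R I a b × IsMinimal I a b

-- 0-tiling on I × J (only entries with indices in I × J matter).
IsZeroTiling : IndexSet → IndexSet → (ℤ → ℤ → ℤ) → Set
IsZeroTiling I J M =
  ∀ i j → i ∈ I → (i + 1ℤ) ∈ I → j ∈ J → (j + 1ℤ) ∈ J →
    M i j * M (i + 1ℤ) (j + 1ℤ) - M i (j + 1ℤ) * M (i + 1ℤ) j ≡ 0ℤ

IsTame : IndexSet → IndexSet → (ℤ → ℤ → ℤ) → Set
IsTame I J M =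
  Σ ℕ λ K → Σ ℕ λ R → Σ ℕ λ S →
    NonZero K × NonZero R × NonZero S ×
    Σ (ℤ → ℤ) λ a → Σ (ℤ → ℤ) λ b → Σ (ℤ → ℤ) λ c → Σ (ℤ → ℤ) λ d →
      IsMinimalPath R I a b × IsMinimalPath S J c d ×
      (∀ i j → i ∈ I → j ∈ J → M i j ≡ + K * a i * d j)

toℚ : ℤ → ℚ
toℚ n = n / 1

-- Along a path in F_R consecutive determinants agree, and subtracting the determinants at
-- i-1 → i and i → i+1 gives b_i (a_{i-1} + a_{i+1}) = a_i (b_{i-1} + b_{i+1}). As a vertex
-- (a_i, b_i) is nonzero, a_{i-1} + a_{i+1} vanishes whenever a_i does, so it is a rational
-- multiple r_i of a_i; likewise d_{j-1} + d_{j+1} = s_j d_j. Since m_ij = K a_i d_j, the rows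
-- and columns of M inherit these recurrences.
module Submission where

open import Defs
open import Data.Integer as ℤ using (ℤ; _+_; _-_; _*_; 1ℤ; 0ℤ; -1ℤ; +_)
import Data.Integer.Properties as ℤP
open import Data.Integer.Tactic.RingSolver using (solve-∀)
open import Data.Rational as ℚ using (ℚ; 0ℚ; 1/_) renaming (_+_ to _+ℚ_; _*_ to _*ℚ_)
import Data.Rational.Properties as ℚP
open import Data.Rational.Unnormalised as ℚᵘ using (mkℚᵘ; *≡*)
import Data.Rational.Unnormalised.Properties as ℚᵘP
open import Data.Maybe using (just; nothing)
open import Data.Product using (Σ; _×_; _,_; proj₁; proj₂; swap)
open import Data.Sum using (inj₁; inj₂)
open import Data.Unit using (tt)
open import Data.Empty using (⊥-elim)
open import Function using (_∘_)
open import Relation.Nullary using (¬_; yes; no)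
open import Relation.Binary.PropositionalEquality
  using (_≡_; refl; sym; trans; cong; cong₂; module ≡-Reasoning)

toℚᵘ-toℚ : ∀ n → ℚ.toℚᵘ (toℚ n) ℚᵘ.≃ mkℚᵘ n 0
toℚᵘ-toℚ n = ℚP.toℚᵘ-fromℚᵘ (mkℚᵘ n 0)

toℚ-homo-+ : ∀ m n → toℚ (m + n) ≡ toℚ m +ℚ toℚ n
toℚ-homo-+ m n = ℚP.toℚᵘ-injective (begin
  ℚ.toℚᵘ (toℚ (m + n))                   ≈⟨ toℚᵘ-toℚ (m + n) ⟩
  mkℚᵘ (m + n) 0                          ≈⟨ *≡* (cong (ℤ._* 1ℤ) (sym (cong₂ _+_ (ℤP.*-identityʳ m) (ℤP.*-identityʳ n)))) ⟩
  mkℚᵘ m 0 ℚᵘ.+ mkℚᵘ n 0                  ≈⟨ ℚᵘP.+-cong (toℚᵘ-toℚ m) (toℚᵘ-toℚ n) ⟨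
  ℚ.toℚᵘ (toℚ m) ℚᵘ.+ ℚ.toℚᵘ (toℚ n)      ≈⟨ ℚP.toℚᵘ-homo-+ (toℚ m) (toℚ n) ⟨
  ℚ.toℚᵘ (toℚ m +ℚ toℚ n)                 ∎)
  where open ℚᵘP.≃-Reasoning

toℚ-homo-* : ∀ m n → toℚ (m * n) ≡ toℚ m *ℚ toℚ n
toℚ-homo-* m n = ℚP.toℚᵘ-injective (begin
  ℚ.toℚᵘ (toℚ (m * n))                   ≈⟨ toℚᵘ-toℚ (m * n) ⟩
  mkℚᵘ m 0 ℚᵘ.* mkℚᵘ n 0                  ≈⟨ ℚᵘP.*-cong (toℚᵘ-toℚ m) (toℚᵘ-toℚ n) ⟨
  ℚ.toℚᵘ (toℚ m) ℚᵘ.* ℚ.toℚᵘ (toℚ n)      ≈⟨ ℚP.toℚᵘ-homo-* (toℚ m) (toℚ n) ⟨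
  ℚ.toℚᵘ (toℚ m *ℚ toℚ n)                 ∎)
  where open ℚᵘP.≃-Reasoning

toℚ-injective : ∀ {m n} → toℚ m ≡ toℚ n → m ≡ n
toℚ-injective {m} {n} eq with ℚP.fromℚᵘ-injective {mkℚᵘ m 0} {mkℚᵘ n 0} eq
... | *≡* m*1≡n*1 = trans (sym (ℤP.*-identityʳ m)) (trans m*1≡n*1 (ℤP.*-identityʳ n))

ratio : ℤ → ℤ → ℚ
ratio p q with q ℤ.≟ 0ℤ
... | yes _   = 0ℚ
... | no q≢0 = toℚ p *ℚ (1/ toℚ q) {{ℚ.≢-nonZero (q≢0 ∘ toℚ-injective)}}

ratio-*-cancel : ∀ p q → (q ≡ 0ℤ → p ≡ 0ℤ) → ratio p q *ℚ toℚ q ≡ toℚ p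
ratio-*-cancel p q q≡0⇒p≡0 with q ℤ.≟ 0ℤ
... | yes q≡0 = trans (ℚP.*-zeroˡ (toℚ q)) (cong toℚ (sym (q≡0⇒p≡0 q≡0)))
... | no q≢0  = begin
  (toℚ p *ℚ 1/ toℚ q) *ℚ toℚ q   ≡⟨ ℚP.*-assoc (toℚ p) (1/ toℚ q) (toℚ q) ⟩
  toℚ p *ℚ (1/ toℚ q *ℚ toℚ q)   ≡⟨ cong (toℚ p *ℚ_) (ℚP.*-inverseˡ (toℚ q)) ⟩
  toℚ p *ℚ ℚ.1ℚ                  ≡⟨ ℚP.*-identityʳ (toℚ p) ⟩
  toℚ p                          ∎
  where
  open ≡-Reasoning
  instance
    toℚq≢0 : ℚ.NonZero (toℚ q)
    toℚq≢0 = ℚ.≢-nonZero (q≢0 ∘ toℚ-injective)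

neighbour-sum-ratio : ∀ (f x : ℤ → ℤ) z i →
  f (i - 1ℤ) ≡ x (i - 1ℤ) * z → f i ≡ x i * z → f (i + 1ℤ) ≡ x (i + 1ℤ) * z →
  (x i ≡ 0ℤ → x (i - 1ℤ) + x (i + 1ℤ) ≡ 0ℤ) →
  toℚ (f (i - 1ℤ)) +ℚ toℚ (f (i + 1ℤ)) ≡ ratio (x (i - 1ℤ) + x (i + 1ℤ)) (x i) *ℚ toℚ (f i)
neighbour-sum-ratio f x z i f₋≡x₋z f₀≡x₀z f₊≡x₊z x₀≡0⇒sum≡0 = begin
  toℚ (f (i - 1ℤ)) +ℚ toℚ (f (i + 1ℤ))  ≡⟨ cong₂ (λ u v → toℚ u +ℚ toℚ v) f₋≡x₋z f₊≡x₊z ⟩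
  toℚ (x₋ * z) +ℚ toℚ (x₊ * z)          ≡⟨ toℚ-homo-+ (x₋ * z) (x₊ * z) ⟨
  toℚ (x₋ * z + x₊ * z)                  ≡⟨ cong toℚ (ℤP.*-distribʳ-+ z x₋ x₊) ⟨
  toℚ ((x₋ + x₊) * z)                    ≡⟨ toℚ-homo-* (x₋ + x₊) z ⟩
  toℚ (x₋ + x₊) *ℚ toℚ z                 ≡⟨ cong (_*ℚ toℚ z) (ratio-*-cancel (x₋ + x₊) x₀ x₀≡0⇒sum≡0) ⟨
  r *ℚ toℚ x₀ *ℚ toℚ z                   ≡⟨ ℚP.*-assoc r (toℚ x₀) (toℚ z) ⟩
  r *ℚ (toℚ x₀ *ℚ toℚ z)                 ≡⟨ cong (r *ℚ_) (toℚ-homo-* x₀ z) ⟨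
  r *ℚ toℚ (x₀ * z)                      ≡⟨ cong (λ u → r *ℚ toℚ u) f₀≡x₀z ⟨
  r *ℚ toℚ (f i)                         ∎
  where
  open ≡-Reasoning
  x₋ = x (i - 1ℤ)
  x₀ = x i
  x₊ = x (i + 1ℤ)
  r = ratio (x₋ + x₊) x₀

LowerOK-mono : ∀ l {i j} → i ℤ.≤ j → LowerOK l i → LowerOK l j
LowerOK-mono nothing  _   _   = tt
LowerOK-mono (just l) i≤j l≤i = ℤP.≤-trans l≤i i≤j

UpperOK-anti : ∀ u {i j} → i ℤ.≤ j → UpperOK u j → UpperOK u i
UpperOK-anti nothing  _   _   = tt
UpperOK-anti (just u) i≤j j≤u = ℤP.≤-trans i≤j j≤u

StrictLower⇒LowerOK-pred : ∀ l {i} → StrictLower l i → LowerOK l (i - 1ℤ)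
StrictLower⇒LowerOK-pred nothing          _   = tt
StrictLower⇒LowerOK-pred (just l) {i} l<i =
  ℤP.≤-trans (ℤP.i<j⇒i≤pred[j] l<i) (ℤP.≤-reflexive (ℤP.+-comm -1ℤ i))

StrictUpper⇒UpperOK-suc : ∀ u {i} → StrictUpper u i → UpperOK u (i + 1ℤ)
StrictUpper⇒UpperOK-suc nothing          _   = tt
StrictUpper⇒UpperOK-suc (just u) {i} i<u =
  ℤP.≤-trans (ℤP.≤-reflexive (ℤP.+-comm i 1ℤ)) (ℤP.i<j⇒suc[i]≤j i<u)

∈*⇒neighbours-∈ : ∀ I i → i ∈* I → (i - 1ℤ) ∈ I × i ∈ I × (i + 1ℤ) ∈ I
∈*⇒neighbours-∈ I i (i>lo , i<hi) =
  (low , UpperOK-anti (hi I) (ℤP.≤-trans i-1≤i i≤i+1) high) ,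
  (LowerOK-mono (lo I) i-1≤i low , UpperOK-anti (hi I) i≤i+1 high) ,
  (LowerOK-mono (lo I) (ℤP.≤-trans i-1≤i i≤i+1) low , high)
  where
  low  = StrictLower⇒LowerOK-pred (lo I) i>lo
  high = StrictUpper⇒UpperOK-suc (hi I) i<hi
  i-1≤i = ℤP.i-j≤i i 1ℤ
  i≤i+1 = ℤP.i≤i+j i 1ℤ

i-1+1≡i : ∀ i → i - 1ℤ + 1ℤ ≡ i
i-1+1≡i i = trans (ℤP.+-assoc i -1ℤ 1ℤ) (ℤP.+-identityʳ i)

equal-determinants⇒neighbour-sums-proportional : ∀ {D} xm x0 xp ym y0 yp →
  xm * y0 - ym * x0 ≡ D → x0 * yp - y0 * xp ≡ D → y0 * (xm + xp) ≡ x0 * (ym + yp)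
equal-determinants⇒neighbour-sums-proportional {D} xm x0 xp ym y0 yp e₁ e₂ =
  ℤP.i-j≡0⇒i≡j _ _ (begin
    y0 * (xm + xp) - x0 * (ym + yp)      ≡⟨ expand xm x0 xp ym y0 yp ⟩
    (xm * y0 - ym * x0) - (x0 * yp - y0 * xp) ≡⟨ cong₂ _-_ e₁ e₂ ⟩
    D - D                                ≡⟨ ℤP.+-inverseʳ D ⟩
    0ℤ                                   ∎)
  where
  open ≡-Reasoning
  expand : ∀ xm x0 xp ym y0 yp →
    y0 * (xm + xp) - x0 * (ym + yp) ≡ (xm * y0 - ym * x0) - (x0 * yp - y0 * xp)
  expand = solve-∀

nonzero-vector-cancel : ∀ {x y s t} → ¬ (x ≡ 0ℤ × y ≡ 0ℤ) → y * s ≡ x * t → x ≡ 0ℤ → s ≡ 0ℤ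
nonzero-vector-cancel {y = y} {s} {t} x,y≢0 ys≡xt refl
  with ℤP.i*j≡0⇒i≡0∨j≡0 y (trans ys≡xt (ℤP.*-zeroˡ t))
... | inj₁ y≡0 = ⊥-elim (x,y≢0 (refl , y≡0))
... | inj₂ s≡0 = s≡0

module _ {R} I (a b : ℤ → ℤ) (path : IsPath R I a b) i (i∈* : i ∈* I) where

  path-neighbour-sums-proportional :
    b i * (a (i - 1ℤ) + a (i + 1ℤ)) ≡ a i * (b (i - 1ℤ) + b (i + 1ℤ))
  path-neighbour-sums-proportional =
    equal-determinants⇒neighbour-sums-proportional
      (a (i - 1ℤ)) (a i) (a (i + 1ℤ)) (b (i - 1ℤ)) (b i) (b (i + 1ℤ))
      edge-into-i (proj₂ path i i∈ i+1∈)
    where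
    neighbours = ∈*⇒neighbours-∈ I i i∈*
    i-1∈ = proj₁ neighbours
    i∈   = proj₁ (proj₂ neighbours)
    i+1∈ = proj₂ (proj₂ neighbours)
    edge-into-i : a (i - 1ℤ) * b i - b (i - 1ℤ) * a i ≡ + R
    edge-into-i with proj₂ path (i - 1ℤ) i-1∈
    ... | edge rewrite i-1+1≡i i = edge i∈

  vertex-nonzero : ¬ (a i ≡ 0ℤ × b i ≡ 0ℤ)
  vertex-nonzero = proj₁ (proj₁ path i (proj₁ (proj₂ (∈*⇒neighbours-∈ I i i∈*))))

  path-numerator-sum-vanishes : a i ≡ 0ℤ → a (i - 1ℤ) + a (i + 1ℤ) ≡ 0ℤ
  path-numerator-sum-vanishes =
    nonzero-vector-cancel vertex-nonzero path-neighbour-sums-proportional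

  path-denominator-sum-vanishes : b i ≡ 0ℤ → b (i - 1ℤ) + b (i + 1ℤ) ≡ 0ℤ
  path-denominator-sum-vanishes =
    nonzero-vector-cancel (vertex-nonzero ∘ swap) (sym path-neighbour-sums-proportional)

lemma7p2 : (I J : IndexSet) (M : ℤ → ℤ → ℤ) →
    IsZeroTiling I J M → IsTame I J M →
    Σ (ℤ → ℚ) λ r → Σ (ℤ → ℚ) λ s →
      ∀ i j → i ∈* I → j ∈* J →
        (toℚ (M (i - 1ℤ) j) +ℚ toℚ (M (i + 1ℤ) j) ≡ r i *ℚ toℚ (M i j)) ×
        (toℚ (M i (j - 1ℤ)) +ℚ toℚ (M i (j + 1ℤ)) ≡ s j *ℚ toℚ (M i j))
lemma7p2 I J M _ (K , _ , _ , _ , _ , _ , a , b , c , d , (a/b-path , _) , (c/d-path , _) , M≡Kad) =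
  (λ i → ratio (a (i - 1ℤ) + a (i + 1ℤ)) (a i)) ,
  (λ j → ratio (d (j - 1ℤ) + d (j + 1ℤ)) (d j)) ,
  recurrences
  where
  row-factor : ∀ k x y → k * x * y ≡ x * (k * y)
  row-factor = solve-∀

  col-factor : ∀ k x y → k * x * y ≡ y * (k * x)
  col-factor = solve-∀

  row-entry : ∀ i j → i ∈ I → j ∈ J → M i j ≡ a i * (+ K * d j)
  row-entry i j i∈ j∈ = trans (M≡Kad i j i∈ j∈) (row-factor (+ K) (a i) (d j))

  col-entry : ∀ i j → i ∈ I → j ∈ J → M i j ≡ d j * (+ K * a i)
  col-entry i j i∈ j∈ = trans (M≡Kad i j i∈ j∈) (col-factor (+ K) (a i) (d j))

  recurrences : ∀ i j → i ∈* I → j ∈* J →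
    (toℚ (M (i - 1ℤ) j) +ℚ toℚ (M (i + 1ℤ) j) ≡ ratio (a (i - 1ℤ) + a (i + 1ℤ)) (a i) *ℚ toℚ (M i j)) ×
    (toℚ (M i (j - 1ℤ)) +ℚ toℚ (M i (j + 1ℤ)) ≡ ratio (d (j - 1ℤ) + d (j + 1ℤ)) (d j) *ℚ toℚ (M i j))
  recurrences i j i∈* j∈*
    with ∈*⇒neighbours-∈ I i i∈* | ∈*⇒neighbours-∈ J j j∈*
  ... | i-1∈ , i∈ , i+1∈ | j-1∈ , j∈ , j+1∈ =
    neighbour-sum-ratio (λ k → M k j) a (+ K * d j) i
      (row-entry (i - 1ℤ) j i-1∈ j∈) (row-entry i j i∈ j∈) (row-entry (i + 1ℤ) j i+1∈ j∈)
      (path-numerator-sum-vanishes I a b a/b-path i i∈*) ,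
    neighbour-sum-ratio (M i) d (+ K * a i) j
      (col-entry i (j - 1ℤ) i∈ j-1∈) (col-entry i j i∈ j∈) (col-entry i (j + 1ℤ) i∈ j+1∈)
      (path-denominator-sum-vanishes J c d c/d-path j j∈*)
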